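{- Let \(\mathcal U\) and \(\mathcal V\) be universes. If Tarski's-Theorem\(_{\mathcal V,\mathcal V^+\sqcup\mathcal U,\mathcal V}\) holds, then Propositional-Resizing\(_{\mathcal U,\mathcal V}\) holds.
   Context: Setting: intensional Martin-Löf type theory with universes (successor \(\mathcal V^+\), join \(\sqcup\)), function extensionality, propositional extensionality, propositional truncation; excluded middle and resizing are not assumed. A proposition is a type with at most one element. Propositional-Resizing\(_{\mathcal U,\mathcal V}\): every proposition in \(\mathcal U\) is equivalent to some type in \(\mathcal V\). A poset is a type with a proposition-valued reflexive, transitive, antisymmetric relation. A \(\mathcal V\)-sup-lattice is a poset with suprema for all families \(I\to X\) with \(I:\mathcal V\). Tarski's-Theorem\(_{\mathcal V,\mathcal U',\mathcal T}\) asserts that every monotone endofunction on a \(\mathcal V\)-sup-lattice whose carrier lies in universe \(\mathcal U'\) and whose order takes values in universe \(\mathcal T\) has a greatest fixed point. -}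

module Defs where

open import Level using (Level; _⊔_; Setω) renaming (suc to lsuc)
open import Data.Product using (Σ; _×_; _,_)
open import Relation.Binary.PropositionalEquality using (_≡_)
open import Function.Bundles using (_↔_)
open import Axiom.Extensionality.Propositional using (Extensionality)

isProp : ∀ {ℓ} → Set ℓ → Set ℓ
isProp A = (x y : A) → x ≡ y

FunExt : Setω
FunExt = ∀ {a b} → Extensionality a b

PropExt : Setω
PropExt = ∀ {ℓ} {P Q : Set ℓ} → isProp P → isProp Q → (P → Q) → (Q → P) → P ≡ Q

record PropTrunc : Setω where
  field
    ∥_∥      : ∀ {ℓ} → Set ℓ → Set ℓ
    ∥∥-isProp : ∀ {ℓ} {A : Set ℓ} → isProp ∥ A ∥
    ∣_∣      : ∀ {ℓ} {A : Set ℓ} → A → ∥ A ∥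
    ∥∥-rec   : ∀ {ℓ ℓ'} {A : Set ℓ} {P : Set ℓ'} → isProp P → (A → P) → ∥ A ∥ → P

record SupLattice (v u t : Level) : Set (lsuc (v ⊔ u ⊔ t)) where
  field
    Carrier   : Set u
    _⊑_       : Carrier → Carrier → Set t
    ⊑-isProp  : ∀ x y → isProp (x ⊑ y)
    ⊑-refl    : ∀ x → x ⊑ x
    ⊑-trans   : ∀ x y z → x ⊑ y → y ⊑ z → x ⊑ z
    ⊑-antisym : ∀ x y → x ⊑ y → y ⊑ x → x ≡ y
    ⋁         : {I : Set v} → (I → Carrier) → Carrier
    ⋁-upper   : {I : Set v} (α : I → Carrier) (i : I) → α i ⊑ ⋁ α
    ⋁-least   : {I : Set v} (α : I → Carrier) (x : Carrier) →
                ((i : I) → α i ⊑ x) → ⋁ α ⊑ x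

module _ {v u t : Level} (L : SupLattice v u t) where
  open SupLattice L

  isMonotone : (Carrier → Carrier) → Set (u ⊔ t)
  isMonotone f = ∀ x y → x ⊑ y → f x ⊑ f y

  isGreatestFixedPoint : (Carrier → Carrier) → Carrier → Set (u ⊔ t)
  isGreatestFixedPoint f x = (f x ≡ x) × (∀ y → f y ≡ y → y ⊑ x)

  HasGreatestFixedPoint : (Carrier → Carrier) → Set (u ⊔ t)
  HasGreatestFixedPoint f = Σ Carrier (isGreatestFixedPoint f)

TarskisTheorem : (v u' t : Level) → Set (lsuc (v ⊔ u' ⊔ t))
TarskisTheorem v u' t =
  (L : SupLattice v u' t) (f : SupLattice.Carrier L → SupLattice.Carrier L) →
  isMonotone L f → HasGreatestFixedPoint L f

PropositionalResizing : (u v : Level) → Set (lsuc (u ⊔ v))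
PropositionalResizing u v = (P : Set u) → isProp P → Σ (Set v) (λ Q → P ↔ Q)

module Submission where

open import Defs
open import Level using (Level; _⊔_; Lift; lift) renaming (suc to lsuc)
open import Data.Product using (Σ; _×_; _,_; proj₁)
open import Data.Unit using (⊤; tt)
open import Relation.Binary.PropositionalEquality using (_≡_; refl; cong₂)
open import Function.Bundles using (_↔_; mk↔ₛ′)
open import Axiom.UniquenessOfIdentityProofs using (UIP; module Constant⇒UIP)

-- The greatest fixed point of the identity map is a greatest element, so
-- Tarski's theorem makes every 𝓥-sup-lattice have a top. Apply this to the
-- lattice of propositions in 𝓥 that imply a given proposition P : 𝓤 (it lives
-- in 𝓥⁺ ⊔ 𝓤, with suprema given by truncated sums): its top is implied by P,
-- because the unit type is below it, and therefore is a copy of P in 𝓥.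

isProp⇒UIP : ∀ {a} {A : Set a} → isProp A → UIP A
isProp⇒UIP A-isProp =
  Constant⇒UIP.≡-irrelevant (λ {x} {y} _ → A-isProp x y) (λ _ _ → refl)

isProp-isProp : FunExt → ∀ {a} {A : Set a} → isProp (isProp A)
isProp-isProp fe h k = fe λ x → fe λ y → isProp⇒UIP h (h x y) (k x y)

module _ {v u t : Level} (L : SupLattice v u t) where
  open SupLattice L

  HasGreatestElement : Set (u ⊔ t)
  HasGreatestElement = Σ Carrier (λ ⊤ → ∀ x → x ⊑ ⊤)

  greatestFixedPoint-id⇒greatestElement :
    HasGreatestFixedPoint L (λ x → x) → HasGreatestElement
  greatestFixedPoint-id⇒greatestElement (⊤ , _ , ⊤-greatest) =
    ⊤ , λ x → ⊤-greatest x refl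

TarskisTheorem⇒greatestElement : ∀ {v u t} → TarskisTheorem v u t →
  (L : SupLattice v u t) → HasGreatestElement L
TarskisTheorem⇒greatestElement tarski L =
  greatestFixedPoint-id⇒greatestElement L (tarski L (λ x → x) (λ _ _ x⊑y → x⊑y))

module PropositionsBelow (fe : FunExt) (pe : PropExt) (pt : PropTrunc)
       (v : Level) {u : Level} {P : Set u} (P-isProp : isProp P) where
  open PropTrunc pt

  PropositionBelow : Set (lsuc v ⊔ u)
  PropositionBelow = Σ (Set v) (λ Q → isProp Q × (Q → P))

  PropositionBelow-≡ : (X Y : PropositionBelow) → proj₁ X ≡ proj₁ Y → X ≡ Y
  PropositionBelow-≡ (Q , Q-isProp , f) (.Q , Q-isProp′ , g) refl =
    cong₂ (λ h k → Q , h , k)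
          (isProp-isProp fe Q-isProp Q-isProp′)
          (fe λ q → P-isProp (f q) (g q))

  propositionsBelow : SupLattice v (lsuc v ⊔ u) v
  propositionsBelow = record
    { Carrier   = PropositionBelow
    ; _⊑_       = λ X Y → proj₁ X → proj₁ Y
    ; ⊑-isProp  = λ { _ (_ , Q-isProp , _) f g → fe λ x → Q-isProp (f x) (g x) }
    ; ⊑-refl    = λ _ x → x
    ; ⊑-trans   = λ _ _ _ f g x → g (f x)
    ; ⊑-antisym = λ { X@(_ , X-isProp , _) Y@(_ , Y-isProp , _) f g →
                      PropositionBelow-≡ X Y (pe X-isProp Y-isProp f g) }
    ; ⋁         = λ {I} α → ∥ Σ I (λ i → proj₁ (α i)) ∥ , ∥∥-isProp ,
                            ∥∥-rec P-isProp (λ { (i , q) → below (α i) q })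
    ; ⋁-upper   = λ _ i q → ∣ i , q ∣
    ; ⋁-least   = λ { _ (_ , Q-isProp , _) α⊑Q →
                      ∥∥-rec Q-isProp (λ { (i , q) → α⊑Q i q }) }
    }
    where
      below : (X : PropositionBelow) → proj₁ X → P
      below (_ , _ , f) = f

  greatestElement⇒resizing : HasGreatestElement propositionsBelow →
    Σ (Set v) (λ Q → P ↔ Q)
  greatestElement⇒resizing ((Q , Q-isProp , Q→P) , greatest) =
    Q , mk↔ₛ′ P→Q Q→P (λ _ → Q-isProp _ _) (λ _ → P-isProp _ _)
    where
      P→Q : P → Q
      P→Q p = greatest (Lift v ⊤ , (λ _ _ → refl) , (λ _ → p)) (lift tt)

theorem4p8 : FunExt → PropExt → PropTrunc →
    (u v : Level) → TarskisTheorem v (lsuc v ⊔ u) v → PropositionalResizing u v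
theorem4p8 fe pe pt u v tarski P P-isProp =
  greatestElement⇒resizing
    (TarskisTheorem⇒greatestElement tarski propositionsBelow)
  where open PropositionsBelow fe pe pt v P-isProp
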